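{- Let $\alpha,n$ be positive integers with $n>\alpha$ and $n\ge2$. For integers $k\ge0$ set $\mathscr{H}^\alpha_{n,k}=|R^{\alpha\text{ -Gib}}(n,k)|$, $\mathscr{G}^\alpha_{n,k}=n^{k\bmod 2}\,\overline{G}^{\alpha,1}_k(n^2)$, and $\mathscr{A}^\alpha_{n,k}=A^{(\alpha;n)}_k(1)$. Then for each $\mathscr{X}\in\{\mathscr{A},\mathscr{G},\mathscr{H}\}$: $\mathscr{X}^\alpha_{n,0}=\alpha$, $\mathscr{X}^\alpha_{n,1}=n$, and $\mathscr{X}^\alpha_{n,k}=n\mathscr{X}^\alpha_{n,k-1}-\mathscr{X}^\alpha_{n,k-2}$ for $k\ge2$. If $n=2$ (so necessarily $\alpha=1$), then $\mathscr{X}^1_{2,k}=k+1$ for all $k\ge0$. If $n>2$, then for all $k\ge0$ \[\mathscr{X}^\alpha_{n,k}=\frac{r_2^{\,k}(n-\alpha r_1)-r_1^{\,k}(n-\alpha r_2)}{r_2-r_1},\] where $r_2$ and $r_1$ are respectively the larger and the smaller of the two distinct real roots of $x^2-nx+1$.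
   Context: For positive integers $\alpha,n$ and $k\ge1$, $R^{\alpha\text{ -Gib}}(n,k)$ is the set of integer $k$-tuples $T=(T_1,\ldots,T_k)$ with (1) $T_j\in\{(j-1)n+1,\ldots,jn\}$ for all $j$; (2) $T_{j+1}\neq T_j+1$ for $1\le j\le k-1$; (3) $(T_1,T_k)\neq(i,nk-i+1)$ for $1\le i\le\alpha-1$; by convention $R^{\alpha\text{ -Gib}}(n,0)$ is an $\alpha$-element set. Sign-alternating Gibonacci polynomials: $\overline{G}^{\alpha,1}_0(x)=\alpha$, $\overline{G}^{\alpha,1}_1(x)=1$, $\overline{G}^{\alpha,1}_k(x)=x^{(k-1)\bmod 2}\overline{G}^{\alpha,1}_{k-1}(x)-\overline{G}^{\alpha,1}_{k-2}(x)$ for $k\ge2$. Symmetric $(\alpha;n)$-Gibonacci triangle: with $\mathcal{I}_{n,k}=\{ -k(n-1),-k(n-1)+2,\ldots,k(n-1)\}$, define $a_{k,r}$ by $a_{k,r}=0$ for $r\notin\mathcal{I}_{n,k}$, $a_{0,0}=\alpha$, $a_{1,r}=1$ for $r\in\mathcal{I}_{n,1}$, and $a_{k,r}=\left(\sum_{s\in\mathcal{I}_{n,1}}a_{k-1,r+s}\right)-a_{k-2,r}$ for $k\ge2$; then $A^{(\alpha;n)}_k(q)=\sum_{r\in\mathcal{I}_{n,k}}a_{k,r}q^{\frac12(k(n-1)-r)}$, so $A^{(\alpha;n)}_k(1)$ is the sum of the entries of row $k$. -}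

module Defs where

open import Data.Nat as ℕ using (ℕ; zero; suc; _∸_; _%_)
open import Data.Integer as ℤ using (ℤ; +_; -_)
open import Data.Rational as ℚ using (ℚ)
open import Data.List using (List; []; _∷_; map; upTo; length; filter; concatMap; foldr)
open import Data.Unit using (⊤)
open import Data.List.Relation.Unary.Any using (any?)
open import Data.List.Relation.Unary.All using (All; all?)
open import Data.Product using (_×_; _,_; proj₁; proj₂)
open import Data.Sum using (_⊎_)
open import Data.Bool using (Bool; true; false; if_then_else_)
open import Relation.Nullary using (¬_; Dec; yes; no; ¬?)
open import Relation.Nullary.Decidable using (_×-dec_; _⊎-dec_; ⌊_⌋)
open import Relation.Binary.PropositionalEquality using (_≡_)

-- all lists (T_1,…,T_k) with T_j ∈ {(j-1)n+1,…,jn}; `blockTuples n j k`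
-- produces the tuples whose first entry lies in block j+1.
blockTuples : ℕ → ℕ → ℕ → List (List ℕ)
blockTuples n j zero    = [] ∷ []
blockTuples n j (suc k) =
  concatMap (λ t → map (λ rest → (j ℕ.* n ℕ.+ suc t) ∷ rest) (blockTuples n (suc j) k))
            (upTo n)

tuples : ℕ → ℕ → List (List ℕ)
tuples n k = blockTuples n 0 k

-- condition (2): T_{j+1} ≠ T_j + 1
NoSucc : List ℕ → Set
NoSucc []            = ⊤
NoSucc (x ∷ [])      = ⊤
NoSucc (x ∷ y ∷ xs)  = ¬ (y ≡ suc x) × NoSucc (y ∷ xs)

noSucc? : (t : List ℕ) → Dec (NoSucc t)
noSucc? []           = yes _
noSucc? (x ∷ [])     = yes _
noSucc? (x ∷ y ∷ xs) = ¬? (y ℕ.≟ suc x) ×-dec noSucc? (y ∷ xs)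

head0 : List ℕ → ℕ
head0 []      = 0
head0 (x ∷ _) = x

last0 : List ℕ → ℕ
last0 []           = 0
last0 (x ∷ [])     = x
last0 (x ∷ y ∷ xs) = last0 (y ∷ xs)

-- condition (3): (T_1,T_k) ≠ (i, nk-i+1) for 1 ≤ i ≤ α-1
-- (imposed for k ≥ 2)
EndCond : ℕ → ℕ → ℕ → List ℕ → Set
EndCond α n k t =
  All (λ i → ¬ (head0 t ≡ i × last0 t ≡ suc (n ℕ.* k ∸ i))) (map suc (upTo (α ∸ 1)))

endCond? : ∀ α n k t → Dec (EndCond α n k t)
endCond? α n k t =
  all? (λ i → ¬? ((head0 t ℕ.≟ i) ×-dec (last0 t ℕ.≟ suc (n ℕ.* k ∸ i))))
       (map suc (upTo (α ∸ 1)))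

IsGib : ℕ → ℕ → ℕ → List ℕ → Set
IsGib α n k t = NoSucc t × EndCond α n k t

isGib? : ∀ α n k t → Dec (IsGib α n k t)
isGib? α n k t = noSucc? t ×-dec endCond? α n k t

RGib : ℕ → ℕ → ℕ → List (List ℕ)
RGib α n 1 = filter noSucc? (tuples n 1)
RGib α n k = filter (isGib? α n k) (tuples n k)

cardRGib : ℕ → ℕ → ℕ → ℕ
cardRGib α n zero    = α            -- convention |R(n,0)| = α
cardRGib α n (suc k) = length (RGib α n (suc k))

ℋ : ℕ → ℕ → ℕ → ℤ
ℋ α n k = + cardRGib α n k

Gbar : ℕ → ℤ → ℕ → ℤ
Gbar α x zero          = + α
Gbar α x (suc zero)    = + 1
Gbar α x (suc (suc k)) = (x ℤ.^ (suc k % 2)) ℤ.* Gbar α x (suc k) ℤ.- Gbar α x k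

𝒢 : ℕ → ℕ → ℕ → ℤ
𝒢 α n k = (+ n) ℤ.^ (k % 2) ℤ.* Gbar α ((+ n) ℤ.* (+ n)) k

sumℤ : List ℤ → ℤ
sumℤ = foldr ℤ._+_ (+ 0)

I : ℕ → ℕ → List ℤ
I n k = map (λ j → - (+ (k ℕ.* (n ∸ 1))) ℤ.+ (+ 2) ℤ.* (+ j)) (upTo (suc (k ℕ.* (n ∸ 1))))

inI : ℕ → ℕ → ℤ → Bool
inI n k r = ⌊ any? (λ s → r ℤ.≟ s) (I n k) ⌋

a : ℕ → ℕ → ℕ → ℤ → ℤ
a α n zero          r = if inI n 0 r then + α else + 0
a α n (suc zero)    r = if inI n 1 r then + 1 else + 0
a α n (suc (suc k)) r =
  if inI n (suc (suc k)) r
  then sumℤ (map (λ s → a α n (suc k) (r ℤ.+ s)) (I n 1)) ℤ.- a α n k r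
  else + 0

-- A^{(α;n)}_k(q) = Σ_{r ∈ I_{n,k}} a_{k,r} q^{(k(n-1)-r)/2}, evaluated at q = 1
A-at-1 : ℕ → ℕ → ℕ → ℤ
A-at-1 α n k = sumℤ (map (a α n k) (I n k))

𝒜 : ℕ → ℕ → ℕ → ℤ
𝒜 α n k = A-at-1 α n k

data Which : Set where
  A G H : Which

𝒳 : Which → ℕ → ℕ → ℕ → ℤ
𝒳 A = 𝒜
𝒳 G = 𝒢
𝒳 H = ℋ

-- the field ℚ(√D): pairs (p , q) standing for p + q √D, D = n² - 4.
-- For n > 2, D is not a perfect square, so p + q√D ↦ real number is an
-- injective ring homomorphism ℚ(√D) → ℝ; identities here are identities in ℝ.

QD : Set
QD = ℚ × ℚ

module QuadExt (D : ℚ) where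
  infixl 6 _⊕_ _⊖_
  infixl 7 _⊗_
  _⊕_ : QD → QD → QD
  (p , q) ⊕ (p' , q') = (p ℚ.+ p' , q ℚ.+ q')
  _⊖_ : QD → QD → QD
  (p , q) ⊖ (p' , q') = (p ℚ.- p' , q ℚ.- q')
  _⊗_ : QD → QD → QD
  (p , q) ⊗ (p' , q') = (p ℚ.* p' ℚ.+ D ℚ.* (q ℚ.* q') , p ℚ.* q' ℚ.+ q ℚ.* p')
  embℤ : ℤ → QD
  embℤ z = (z ℚ./ 1 , ℚ.0ℚ)
  _^'_ : QD → ℕ → QD
  x ^' zero  = (ℚ.1ℚ , ℚ.0ℚ)
  x ^' suc k = x ⊗ (x ^' k)

disc : ℕ → ℚ
disc n = (+ (n ℕ.* n) ℤ.- + 4) ℚ./ 1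

-- larger root r₂ = (n + √D)/2 and smaller root r₁ = (n - √D)/2 of x² - n x + 1
r₂ : ℕ → QD
r₂ n = ((+ n) ℚ./ 2 , ℚ.½)

r₁ : ℕ → QD
r₁ n = ((+ n) ℚ./ 2 , ℚ.- ℚ.½)

ClosedForm : ℕ → ℕ → ℕ → ℤ → Set
ClosedForm α n k X =
  (r₂ n ⊖ r₁ n) ⊗ embℤ X
    ≡ (r₂ n ^' k) ⊗ (embℤ (+ n) ⊖ embℤ (+ α) ⊗ r₁ n)
      ⊖ (r₁ n ^' k) ⊗ (embℤ (+ n) ⊖ embℤ (+ α) ⊗ r₂ n)
  where open QuadExt (disc n)

-- All three sequences start with α, n and satisfy x (k + 2) = n x (k + 1) − x k; both the
-- case n = 2 and the closed form follow from the recurrence alone, the latter being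
-- Binet's formula, which holds in any commutative ring containing two roots of
-- x² − n x + 1 and is applied in ℚ(√(n² − 4)).
--
-- For 𝒢 the recurrence is a parity computation.  For 𝒜, entry (k + 2, r) of the triangle
-- is the sum of the n entries a (k + 1, r + s), s ∈ I_{n,1}, minus a (k, r); summing over
-- r counts every entry of row k + 1 exactly n times.  For ℋ, condition (2) is a two-state
-- transfer matrix: a continuation through m further blocks can be chosen in V m ways, or
-- in W m ways when the previous entry ends its block, and V (m + 1) − W (m + 1) = V m
-- gives the recurrence for V.  Condition (3) then removes, for each first entry i < α,
-- the V k tuples with T_{k+2} fixed, so that ℋ (k + 2) = V (k + 2) − (α − 1) V k.
module Submission where

open import Defs
open import Data.Nat using (ℕ; suc; _≤_; _<_)
open import Data.Integer using (ℤ; +_)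
open import Data.Product using (_×_)
open import Relation.Binary.PropositionalEquality using (_≡_)

open import Algebra.Bundles using (CommutativeRing)
open import Algebra.Bundles.Raw using (RawRing)
open import Algebra.Structures using (IsCommutativeRing)
open import Algebra.Consequences.Propositional using (comm∧idˡ⇒id; comm∧distrˡ⇒distrʳ)
open import Data.Bool using (Bool; true; false; if_then_else_; not; _∧_)
import Data.Bool.Properties as Bool
open import Data.Integer as ℤ using (0ℤ; 1ℤ)
import Data.Integer.Properties as ℤ
open import Data.Integer.Tactic.RingSolver as ℤ-Solver using ()
open import Data.List using (List; []; _∷_; map; upTo; applyUpTo; concatMap; length; filter; _++_)
open import Data.List.Properties using (map-∘)
import Data.List.Relation.Unary.All.Properties as All
open import Data.List.Relation.Unary.Any using (any?)
import Data.List.Relation.Unary.Any.Properties as Any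
open import Data.Nat as ℕ using (zero; _∸_; s≤s; z<s; s<s)
import Data.Nat.Properties as ℕ
open import Data.Nat.Tactic.RingSolver as ℕ-Solver using ()
open import Data.Product using (_,_; proj₁)
open import Data.Rational using (ℚ; 0ℚ; 1ℚ; ½; toℚᵘ)
import Data.Rational.Properties as ℚ
open import Data.Rational.Unnormalised as ℚᵘ using (mkℚᵘ; *≡*)
import Data.Rational.Unnormalised.Properties as ℚᵘ
open import Data.Sum using (_⊎_; inj₁; inj₂)
open import Function using (_∘_; _⇔_; mk⇔)
open import Level using (0ℓ)
open import Relation.Binary.PropositionalEquality
  using (refl; sym; trans; cong; cong₂; subst; _≢_; isEquivalence; module ≡-Reasoning)
open import Relation.Nullary using (¬?; does)
open import Relation.Nullary.Decidable using (dec-true; dec-false; does-⇔; isYes≗does; dec⇒maybe)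
open import Relation.Unary using (Decidable)
open import Tactic.RingSolver using (solve-∀)
open import Tactic.RingSolver.Core.AlmostCommutativeRing using (AlmostCommutativeRing; fromCommutativeRing)

module LinearRecurrence {c ℓ} (R : CommutativeRing c ℓ) where

  open CommutativeRing R renaming (refl to ≈-refl; sym to ≈-sym; trans to ≈-trans)
  open import Algebra.Definitions.RawSemiring (RawRing.rawSemiring rawRing) using (_^_) public
  open import Algebra.Properties.Ring ring using (x[y-z]≈xy-xz; [y-z]x≈yx-zx)
  open import Algebra.Properties.AbelianGroup +-abelianGroup using (⁻¹-anti-homo‿-; xyx⁻¹≈y; ⁻¹-∙-comm)
  open import Algebra.Properties.Group +-group using (//-rightDividesˡ; //-rightDividesʳ)
  -- The ring solvers need decidable equality of coefficients, which R lacks; the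
  -- commutative-semiring solver works over ℕ-coefficients, with negated terms as atoms.
  open import Algebra.Solver.Ring.NaturalCoefficients.Default commutativeSemiring
    using (solve; _:=_; _:+_; _:*_; con)
  open import Relation.Binary.Reasoning.Setoid setoid

  Recurrence : Carrier → (ℕ → Carrier) → Set ℓ
  Recurrence N x = ∀ k → x (suc (suc k)) ≈ N * x (suc k) - x k

  private
    add-back : ∀ {x y z} → x ≈ y - z → x + z ≈ y
    add-back {x} {y} {z} eq = ≈-trans (+-congʳ eq) (//-rightDividesˡ z y)

    subtract : ∀ {x y z} → x + z ≈ y → x ≈ y - z
    subtract {x} {y} {z} eq = ≈-trans (≈-sym (//-rightDividesʳ z x)) (+-congʳ eq)

    [b-u]-[b-v]≈v-u : ∀ b u v → (b - u) - (b - v) ≈ v - u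
    [b-u]-[b-v]≈v-u b u v = begin
      (b - u) - (b - v)   ≈⟨ +-congˡ (⁻¹-anti-homo‿- b v) ⟩
      (b - u) + (v - b)   ≈⟨ swap b (- u) v (- b) ⟩
      b + (v - u) - b     ≈⟨ xyx⁻¹≈y b (v - u) ⟩
      v - u               ∎
      where swap = solve 4 (λ b u′ v b′ → (b :+ u′) :+ (v :+ b′) := b :+ (v :+ u′) :+ b′) ≈-refl

    [x-t]-[y-t]≈x-y : ∀ x y t → (x - t) - (y - t) ≈ x - y
    [x-t]-[y-t]≈x-y x y t = begin
      (x - t) - (y - t)   ≈⟨ +-congˡ (⁻¹-anti-homo‿- y t) ⟩
      (x - t) + (t - y)   ≈⟨ swap x (- t) t (- y) ⟩
      t + (x - y) - t     ≈⟨ xyx⁻¹≈y t (x - y) ⟩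
      x - y               ∎
      where swap = solve 4 (λ x t′ t y′ → (x :+ t′) :+ (t :+ y′) := t :+ (x :+ y′) :+ t′) ≈-refl

  module _ {N : Carrier} where

    recurrence-unique : ∀ {x y} → Recurrence N x → Recurrence N y →
                        x 0 ≈ y 0 → x 1 ≈ y 1 → ∀ k → x k ≈ y k
    recurrence-unique {x} {y} rx ry x₀ x₁ k = proj₁ (agree k)
      where
      agree : ∀ k → x k ≈ y k × x (suc k) ≈ y (suc k)
      agree zero    = x₀ , x₁
      agree (suc k) = let (eq , eq′) = agree k in
        eq′ , ≈-trans (rx k) (≈-trans (+-cong (*-congˡ eq′) (-‿cong eq)) (≈-sym (ry k)))

    recurrence-*ˡ : ∀ a {x} → Recurrence N x → Recurrence N (λ k → a * x k)
    recurrence-*ˡ a {x} rx k = subtract (begin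
      a * x (suc (suc k)) + a * x k   ≈⟨ ≈-sym (distribˡ a _ _) ⟩
      a * (x (suc (suc k)) + x k)     ≈⟨ *-congˡ (add-back (rx k)) ⟩
      a * (N * x (suc k))             ≈⟨ swap a N (x (suc k)) ⟩
      N * (a * x (suc k))             ∎)
      where swap = solve 3 (λ a N y → a :* (N :* y) := N :* (a :* y)) ≈-refl

    recurrence-− : ∀ {x y} → Recurrence N x → Recurrence N y → Recurrence N (λ k → x k - y k)
    recurrence-− {x} {y} rx ry k = subtract (begin
      (x₂ - y₂) + (x₀ - y₀)        ≈⟨ interchange x₂ (- y₂) x₀ (- y₀) ⟩
      (x₂ + x₀) + (- y₂ + - y₀)    ≈⟨ +-cong (add-back (rx k)) (⁻¹-∙-comm y₂ y₀) ⟩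
      N * x₁ - (y₂ + y₀)           ≈⟨ +-congˡ (-‿cong (add-back (ry k))) ⟩
      N * x₁ - N * y₁              ≈⟨ ≈-sym (x[y-z]≈xy-xz N x₁ y₁) ⟩
      N * (x₁ - y₁)                ∎)
      where
      x₀ = x k ; x₁ = x (suc k) ; x₂ = x (suc (suc k))
      y₀ = y k ; y₁ = y (suc k) ; y₂ = y (suc (suc k))
      interchange = solve 4 (λ a b c d → (a :+ b) :+ (c :+ d) := (a :+ c) :+ (b :+ d)) ≈-refl

    recurrence-root : ∀ {r} → r * r + 1# ≈ N * r → ∀ a → Recurrence N (λ k → r ^ k * a)
    recurrence-root {r} root a k = subtract (begin
      r * (r * r ^ k) * a + r ^ k * a   ≈⟨ factor r (r ^ k) a ⟩
      (r * r + 1#) * (r ^ k * a)        ≈⟨ *-congʳ root ⟩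
      N * r * (r ^ k * a)               ≈⟨ reassociate N r (r ^ k) a ⟩
      N * (r * r ^ k * a)               ∎)
      where
      factor = solve 3 (λ r p a → r :* (r :* p) :* a :+ p :* a := (r :* r :+ con 1) :* (p :* a)) ≈-refl
      reassociate = solve 4 (λ N r p a → N :* r :* (p :* a) := N :* (r :* p :* a)) ≈-refl

    binet : ∀ {r s x a b} → r * r + 1# ≈ N * r → s * s + 1# ≈ N * s →
            Recurrence N x → x 0 ≈ a → x 1 ≈ b →
            ∀ k → (r - s) * x k ≈ r ^ k * (b - a * s) - s ^ k * (b - a * r)
    binet {r} {s} {x} {a} {b} r-root s-root rx x₀ x₁ =
      recurrence-unique (recurrence-*ˡ (r - s) rx)
                        (recurrence-− (recurrence-root r-root _) (recurrence-root s-root _))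
                        initial₀ initial₁
      where
      initial₀ : (r - s) * x 0 ≈ 1# * (b - a * s) - 1# * (b - a * r)
      initial₀ = begin
        (r - s) * x 0                     ≈⟨ *-congˡ x₀ ⟩
        (r - s) * a                       ≈⟨ [y-z]x≈yx-zx a r s ⟩
        r * a - s * a                     ≈⟨ +-cong (*-comm r a) (-‿cong (*-comm s a)) ⟩
        a * r - a * s                     ≈⟨ [b-u]-[b-v]≈v-u b (a * s) (a * r) ⟨
        (b - a * s) - (b - a * r)         ≈⟨ +-cong (*-identityˡ _) (-‿cong (*-identityˡ _)) ⟨
        1# * (b - a * s) - 1# * (b - a * r) ∎
      initial₁ : (r - s) * x 1 ≈ r * 1# * (b - a * s) - s * 1# * (b - a * r)
      initial₁ = begin
        (r - s) * x 1                     ≈⟨ *-congˡ x₁ ⟩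
        (r - s) * b                       ≈⟨ [y-z]x≈yx-zx b r s ⟩
        r * b - s * b                     ≈⟨ [x-t]-[y-t]≈x-y (r * b) (s * b) (r * (a * s)) ⟨
        (r * b - r * (a * s)) - (s * b - r * (a * s))
          ≈⟨ +-congˡ (-‿cong (+-congˡ (-‿cong (swap r a s)))) ⟩
        (r * b - r * (a * s)) - (s * b - s * (a * r))
          ≈⟨ +-cong (x[y-z]≈xy-xz r b (a * s)) (-‿cong (x[y-z]≈xy-xz s b (a * r))) ⟨
        r * (b - a * s) - s * (b - a * r)
          ≈⟨ +-cong (*-congʳ (*-identityʳ r)) (-‿cong (*-congʳ (*-identityʳ s))) ⟨
        r * 1# * (b - a * s) - s * 1# * (b - a * r) ∎
        where swap = solve 3 (λ r a s → r :* (a :* s) := s :* (a :* r)) ≈-refl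

module _ where

  open import Data.Rational using (_+_; _*_; _-_; -_; _/_)

  ℚ-ring : AlmostCommutativeRing 0ℓ 0ℓ
  ℚ-ring = fromCommutativeRing ℚ.+-*-commutativeRing (λ x → dec⇒maybe (0ℚ ℚ.≟ x))

  private
    toℚᵘ-/1 : ∀ z → toℚᵘ (z / 1) ℚᵘ.≃ mkℚᵘ z 0
    toℚᵘ-/1 z = ℚ.toℚᵘ-fromℚᵘ (mkℚᵘ z 0)

  /1-homo-+ : ∀ a b → (a ℤ.+ b) / 1 ≡ (a / 1) + (b / 1)
  /1-homo-+ a b = ℚ.toℚᵘ-injective (ℚᵘ.≃-trans (toℚᵘ-/1 (a ℤ.+ b)) (ℚᵘ.≃-trans (*≡* (eq a b))
    (ℚᵘ.≃-sym (ℚᵘ.≃-trans (ℚ.toℚᵘ-homo-+ (a / 1) (b / 1)) (ℚᵘ.+-cong (toℚᵘ-/1 a) (toℚᵘ-/1 b))))))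
    where
    eq : ∀ a b → (a ℤ.+ b) ℤ.* + 1 ≡ (a ℤ.* + 1 ℤ.+ b ℤ.* + 1) ℤ.* + 1
    eq = ℤ-Solver.solve-∀

  /1-homo-* : ∀ a b → (a ℤ.* b) / 1 ≡ (a / 1) * (b / 1)
  /1-homo-* a b = ℚ.toℚᵘ-injective (ℚᵘ.≃-trans (toℚᵘ-/1 (a ℤ.* b))
    (ℚᵘ.≃-sym (ℚᵘ.≃-trans (ℚ.toℚᵘ-homo-* (a / 1) (b / 1)) (ℚᵘ.*-cong (toℚᵘ-/1 a) (toℚᵘ-/1 b)))))

  /1-homo‿- : ∀ a → (ℤ.- a) / 1 ≡ - (a / 1)
  /1-homo‿- a = ℚ.toℚᵘ-injective (ℚᵘ.≃-trans (toℚᵘ-/1 (ℤ.- a))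
    (ℚᵘ.≃-sym (ℚᵘ.≃-trans (ℚ.toℚᵘ-homo‿- (a / 1)) (ℚᵘ.-‿cong (toℚᵘ-/1 a)))))

  n/2≡n*½ : ∀ n → (+ n) / 2 ≡ ((+ n) / 1) * ½
  n/2≡n*½ n = ℚ.toℚᵘ-injective (ℚᵘ.≃-trans (ℚ.toℚᵘ-fromℚᵘ (mkℚᵘ (+ n) 1)) (ℚᵘ.≃-trans (*≡* (eq (+ n)))
    (ℚᵘ.≃-sym (ℚᵘ.≃-trans (ℚ.toℚᵘ-homo-* ((+ n) / 1) ½) (ℚᵘ.*-cong (toℚᵘ-/1 (+ n)) ℚᵘ.≃-refl)))))
    where
    eq : ∀ a → a ℤ.* + 2 ≡ (a ℤ.* + 1) ℤ.* + 2
    eq = ℤ-Solver.solve-∀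

  disc≡n²-4 : ∀ n → disc n ≡ ((+ n) / 1) * ((+ n) / 1) - (+ 4) / 1
  disc≡n²-4 n = begin
    (+ (n ℕ.* n) ℤ.- + 4) / 1               ≡⟨ /1-homo-+ (+ (n ℕ.* n)) (ℤ.- + 4) ⟩
    (+ (n ℕ.* n)) / 1 + (ℤ.- + 4) / 1       ≡⟨ cong₂ _+_ (cong (_/ 1) (ℤ.pos-* n n)) (/1-homo‿- (+ 4)) ⟩
    (+ n ℤ.* + n) / 1 - (+ 4) / 1           ≡⟨ cong (_- (+ 4) / 1) (/1-homo-* (+ n) (+ n)) ⟩
    ((+ n) / 1) * ((+ n) / 1) - (+ 4) / 1   ∎
    where open ≡-Reasoning

  module QuadraticExtension (D : ℚ) where
    open QuadExt D

    ⊝_ : QD → QD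
    ⊝ (p , q) = (- p , - q)

    +-*-isCommutativeRing : IsCommutativeRing _≡_ _⊕_ _⊗_ ⊝_ (0ℚ , 0ℚ) (1ℚ , 0ℚ)
    +-*-isCommutativeRing = record
      { isRing = record
        { +-isAbelianGroup = record
          { isGroup = record
            { isMonoid = record
              { isSemigroup = record
                { isMagma = record { isEquivalence = isEquivalence ; ∙-cong = cong₂ _⊕_ }
                ; assoc = λ (a , b) (c , d) (e , f) → cong₂ _,_ (ℚ.+-assoc a c e) (ℚ.+-assoc b d f)
                }
              ; identity = (λ (a , b) → cong₂ _,_ (ℚ.+-identityˡ a) (ℚ.+-identityˡ b))
                         , (λ (a , b) → cong₂ _,_ (ℚ.+-identityʳ a) (ℚ.+-identityʳ b))
              }
            ; inverse = (λ (a , b) → cong₂ _,_ (ℚ.+-inverseˡ a) (ℚ.+-inverseˡ b))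
                      , (λ (a , b) → cong₂ _,_ (ℚ.+-inverseʳ a) (ℚ.+-inverseʳ b))
            ; ⁻¹-cong = cong ⊝_
            }
          ; comm = λ (a , b) (c , d) → cong₂ _,_ (ℚ.+-comm a c) (ℚ.+-comm b d)
          }
        ; *-cong = cong₂ _⊗_
        ; *-assoc = ⊗-assoc
        ; *-identity = comm∧idˡ⇒id ⊗-comm ⊗-identityˡ
        ; distrib = distribˡ , comm∧distrˡ⇒distrʳ ⊗-comm distribˡ
        }
      ; *-comm = ⊗-comm
      }
      where
      ⊗-comm : ∀ x y → x ⊗ y ≡ y ⊗ x
      ⊗-comm (a , b) (c , d) = cong₂ _,_ (re D a b c d) (im a b c d)
        where
        re : ∀ D a b c d → a * c + D * (b * d) ≡ c * a + D * (d * b)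
        re = solve-∀ ℚ-ring
        im : ∀ a b c d → a * d + b * c ≡ c * b + d * a
        im = solve-∀ ℚ-ring
      ⊗-assoc : ∀ x y z → (x ⊗ y) ⊗ z ≡ x ⊗ (y ⊗ z)
      ⊗-assoc (a , b) (c , d) (e , f) = cong₂ _,_ (re D a b c d e f) (im D a b c d e f)
        where
        re : ∀ D a b c d e f → (a * c + D * (b * d)) * e + D * ((a * d + b * c) * f)
                             ≡ a * (c * e + D * (d * f)) + D * (b * (c * f + d * e))
        re = solve-∀ ℚ-ring
        im : ∀ D a b c d e f → (a * c + D * (b * d)) * f + (a * d + b * c) * e
                             ≡ a * (c * f + d * e) + b * (c * e + D * (d * f))
        im = solve-∀ ℚ-ring
      ⊗-identityˡ : ∀ x → (1ℚ , 0ℚ) ⊗ x ≡ x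
      ⊗-identityˡ (a , b) = cong₂ _,_ (re D a b) (im a b)
        where
        re : ∀ D a b → 1ℚ * a + D * (0ℚ * b) ≡ a
        re = solve-∀ ℚ-ring
        im : ∀ a b → 1ℚ * b + 0ℚ * a ≡ b
        im = solve-∀ ℚ-ring
      distribˡ : ∀ x y z → x ⊗ (y ⊕ z) ≡ x ⊗ y ⊕ x ⊗ z
      distribˡ (a , b) (c , d) (e , f) = cong₂ _,_ (re D a b c d e f) (im a b c d e f)
        where
        re : ∀ D a b c d e f → a * (c + e) + D * (b * (d + f))
                             ≡ (a * c + D * (b * d)) + (a * e + D * (b * f))
        re = solve-∀ ℚ-ring
        im : ∀ a b c d e f → a * (d + f) + b * (c + e) ≡ (a * d + b * c) + (a * f + b * e)
        im = solve-∀ ℚ-ring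

    +-*-commutativeRing : CommutativeRing 0ℓ 0ℓ
    +-*-commutativeRing = record { isCommutativeRing = +-*-isCommutativeRing }

  module Binet (n : ℕ) where
    open QuadExt (disc n)

    n/2+ε√D-isRoot : ∀ ε → ε * ε ≡ ½ * ½ →
      ((+ n) / 2 , ε) ⊗ ((+ n) / 2 , ε) ⊕ (1ℚ , 0ℚ) ≡ embℤ (+ n) ⊗ ((+ n) / 2 , ε)
    n/2+ε√D-isRoot ε ε² rewrite n/2≡n*½ n | disc≡n²-4 n | ε² =
      cong₂ _,_ (re ((+ n) / 1) ε) (im ((+ n) / 1) ε)
      where
      re : ∀ m ε → (m * ½) * (m * ½) + (m * m - (+ 4) / 1) * (½ * ½) + 1ℚ
                   ≡ m * (m * ½) + (m * m - (+ 4) / 1) * (0ℚ * ε)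
      re = solve-∀ ℚ-ring
      im : ∀ m ε → (m * ½) * ε + ε * (m * ½) + 0ℚ ≡ m * ε + 0ℚ * (m * ½)
      im = solve-∀ ℚ-ring

    open LinearRecurrence (QuadraticExtension.+-*-commutativeRing (disc n))

    embℤ-recurrence : ∀ {N x} → (∀ k → x (suc (suc k)) ≡ N ℤ.* x (suc k) ℤ.- x k) →
                      Recurrence (embℤ N) (embℤ ∘ x)
    embℤ-recurrence {N} {x} rec k = cong₂ _,_ re (im (N / 1) (x (suc k) / 1))
      where
      open ≡-Reasoning
      cast : ∀ D a b c → a * b - c ≡ a * b + D * (0ℚ * 0ℚ) + - c
      cast = solve-∀ ℚ-ring
      im : ∀ a b → 0ℚ ≡ a * 0ℚ + 0ℚ * b + - 0ℚ
      im = solve-∀ ℚ-ring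
      re : x (suc (suc k)) / 1 ≡ (N / 1) * (x (suc k) / 1) + disc n * (0ℚ * 0ℚ) + - (x k / 1)
      re = begin
        x (suc (suc k)) / 1                        ≡⟨ cong (_/ 1) (rec k) ⟩
        (N ℤ.* x (suc k) ℤ.- x k) / 1              ≡⟨ /1-homo-+ (N ℤ.* x (suc k)) (ℤ.- x k) ⟩
        (N ℤ.* x (suc k)) / 1 + (ℤ.- x k) / 1      ≡⟨ cong₂ _+_ (/1-homo-* N (x (suc k))) (/1-homo‿- (x k)) ⟩
        (N / 1) * (x (suc k) / 1) - x k / 1        ≡⟨ cast (disc n) (N / 1) (x (suc k) / 1) (x k / 1) ⟩
        (N / 1) * (x (suc k) / 1) + disc n * (0ℚ * 0ℚ) + - (x k / 1) ∎

    closed-form : ∀ α (X : ℕ → ℤ) → X 0 ≡ + α → X 1 ≡ + n →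
                  (∀ k → X (suc (suc k)) ≡ + n ℤ.* X (suc k) ℤ.- X k) →
                  ∀ k → ClosedForm α n k (X k)
    closed-form α X X₀ X₁ rec k = trans
      (binet {N = embℤ (+ n)} {x = embℤ ∘ X} (n/2+ε√D-isRoot ½ refl) (n/2+ε√D-isRoot (- ½) refl)
             (embℤ-recurrence {+ n} {X} rec) (cong embℤ X₀) (cong embℤ X₁) k)
      (cong₂ (λ u v → u ⊗ _ ⊖ v ⊗ _) (^≡^' (r₂ n) k) (^≡^' (r₁ n) k))
      where
      ^≡^' : ∀ x k → x ^ k ≡ x ^' k
      ^≡^' x zero    = refl
      ^≡^' x (suc k) = cong (x ⊗_) (^≡^' x k)

∑ : ℕ → (ℕ → ℤ) → ℤ
∑ zero    f = 0ℤ
∑ (suc N) f = f 0 ℤ.+ ∑ N (f ∘ suc)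

syntax ∑ N (λ j → e) = ∑[ j < N ] e

sumℤ-map-applyUpTo : ∀ (f : ℕ → ℤ) g N → sumℤ (map f (applyUpTo g N)) ≡ ∑ N (f ∘ g)
sumℤ-map-applyUpTo f g zero    = refl
sumℤ-map-applyUpTo f g (suc N) = cong (ℤ._+_ (f (g 0))) (sumℤ-map-applyUpTo f (g ∘ suc) N)

∑-cong : ∀ N {f g : ℕ → ℤ} → (∀ j → j < N → f j ≡ g j) → ∑ N f ≡ ∑ N g
∑-cong zero    eq = refl
∑-cong (suc N) eq = cong₂ ℤ._+_ (eq 0 z<s) (∑-cong N (λ j → eq (suc j) ∘ s<s))

∑-const : ∀ N c → ∑[ _ < N ] c ≡ + N ℤ.* c
∑-const zero    c = sym (ℤ.*-zeroˡ c)
∑-const (suc N) c = trans (cong (ℤ._+_ c) (∑-const N c)) (sym (ℤ.suc-* (+ N) c))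

∑-zero : ∀ N {f : ℕ → ℤ} → (∀ j → j < N → f j ≡ 0ℤ) → ∑ N f ≡ 0ℤ
∑-zero N eq = trans (∑-cong N eq) (trans (∑-const N 0ℤ) (ℤ.*-zeroʳ (+ N)))

∑-single : ∀ N {f : ℕ → ℤ} c → c < N → (∀ t → t < N → t ≢ c → f t ≡ 0ℤ) → ∑ N f ≡ f c
∑-single (suc N) {f} zero _ others =
  trans (cong (ℤ._+_ (f 0)) (∑-zero N λ t t<N → others (suc t) (s<s t<N) λ ())) (ℤ.+-identityʳ _)
∑-single (suc N) (suc c) (s<s c<N) others =
  trans (cong₂ ℤ._+_ (others 0 z<s λ ())
                     (∑-single N c c<N λ t t<N t≢c → others (suc t) (s<s t<N) (t≢c ∘ ℕ.suc-injective)))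
        (ℤ.+-identityˡ _)

∑-snoc : ∀ N (f : ℕ → ℤ) → ∑ (suc N) f ≡ ∑ N f ℤ.+ f N
∑-snoc zero    f = ℤ.+-comm (f 0) 0ℤ
∑-snoc (suc N) f = trans (cong (ℤ._+_ (f 0)) (∑-snoc N (f ∘ suc))) (sym (ℤ.+-assoc (f 0) _ _))

∑-split : ∀ M N (f : ℕ → ℤ) → ∑ (M ℕ.+ N) f ≡ ∑ M f ℤ.+ ∑[ j < N ] f (M ℕ.+ j)
∑-split zero    N f = sym (ℤ.+-identityˡ _)
∑-split (suc M) N f = trans (cong (ℤ._+_ (f 0)) (∑-split M N (f ∘ suc))) (sym (ℤ.+-assoc (f 0) _ _))

∑-distrib-+ : ∀ N (f g : ℕ → ℤ) → ∑[ j < N ] (f j ℤ.+ g j) ≡ ∑ N f ℤ.+ ∑ N g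
∑-distrib-+ zero    f g = refl
∑-distrib-+ (suc N) f g =
  trans (cong (ℤ._+_ (f 0 ℤ.+ g 0)) (∑-distrib-+ N (f ∘ suc) (g ∘ suc))) (interchange (f 0) (g 0) _ _)
  where
  interchange : ∀ a b c d → (a ℤ.+ b) ℤ.+ (c ℤ.+ d) ≡ (a ℤ.+ c) ℤ.+ (b ℤ.+ d)
  interchange = ℤ-Solver.solve-∀

∑-distrib-− : ∀ N (f g : ℕ → ℤ) → ∑[ j < N ] (f j ℤ.- g j) ≡ ∑ N f ℤ.- ∑ N g
∑-distrib-− N f g = begin
  ∑[ j < N ] (f j ℤ.- g j)            ≡⟨ ∑-distrib-+ N f (ℤ.-_ ∘ g) ⟩
  ∑ N f ℤ.+ ∑[ j < N ] (ℤ.- g j)        ≡⟨ cong (ℤ._+_ (∑ N f)) (∑-neg N) ⟩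
  ∑ N f ℤ.- ∑ N g                     ∎
  where
  open ≡-Reasoning
  ∑-neg : ∀ N {g} → ∑[ j < N ] (ℤ.- g j) ≡ ℤ.- ∑ N g
  ∑-neg zero    = refl
  ∑-neg (suc N) {g} = trans (cong (ℤ._+_ (ℤ.- g 0)) (∑-neg N)) (sym (ℤ.neg-distrib-+ (g 0) _))

∑-comm : ∀ M N (f : ℕ → ℕ → ℤ) → ∑[ i < M ] ∑[ j < N ] f i j ≡ ∑[ j < N ] ∑[ i < M ] f i j
∑-comm zero    N f = sym (∑-zero N (λ _ _ → refl))
∑-comm (suc M) N f = trans (cong (ℤ._+_ (∑ N (f 0))) (∑-comm M N (f ∘ suc)))
                           (sym (∑-distrib-+ N (f 0) (λ j → ∑[ i < M ] f (suc i) j)))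

-- grid (k (n − 1)) enumerates I_{n,k}.
grid : ℕ → ℕ → ℤ
grid K j = ℤ.- (+ K) ℤ.+ (+ 2) ℤ.* (+ j)

grid-injective : ∀ K {i j} → grid K i ≡ grid K j → i ≡ j
grid-injective K {i} {j} eq = ℤ.+-injective (ℤ.*-cancelˡ-≡ (+ 2) (+ i) (+ j) (begin
  (+ 2) ℤ.* (+ i)          ≡⟨ unshift (+ K) (+ i) ⟩
  + K ℤ.+ grid K i         ≡⟨ cong (ℤ._+_ (+ K)) eq ⟩
  + K ℤ.+ grid K j         ≡⟨ unshift (+ K) (+ j) ⟨
  (+ 2) ℤ.* (+ j)          ∎))
  where
  open ≡-Reasoning
  unshift : ∀ K i → (+ 2) ℤ.* i ≡ K ℤ.+ (ℤ.- K ℤ.+ (+ 2) ℤ.* i)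
  unshift = ℤ-Solver.solve-∀

grid-recentre : ∀ d K i → grid (d ℕ.+ (d ℕ.+ K)) (d ℕ.+ i) ≡ grid K i
grid-recentre d K i = shift (+ d) (+ K) (+ i)
  where
  shift : ∀ d K i → ℤ.- (d ℤ.+ (d ℤ.+ K)) ℤ.+ (+ 2) ℤ.* (d ℤ.+ i) ≡ ℤ.- K ℤ.+ (+ 2) ℤ.* i
  shift = ℤ-Solver.solve-∀

OffGrid : ℕ → ℤ → Set
OffGrid K r = ∀ i → i < suc K → r ≢ grid K i

VanishesOffGrid : ℕ → (ℤ → ℤ) → Set
VanishesOffGrid K f = ∀ r → OffGrid K r → f r ≡ 0ℤ

-- The first d + (K + 1) + e points of grid (2d + K) are d points left of grid K, then
-- grid K itself, then e points to its right.
∑-window : ∀ K d e {f} → VanishesOffGrid K f →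
           ∑ (d ℕ.+ (suc K ℕ.+ e)) (f ∘ grid (d ℕ.+ (d ℕ.+ K))) ≡ ∑ (suc K) (f ∘ grid K)
∑-window K d e {f} vanish = begin
  ∑ (d ℕ.+ (suc K ℕ.+ e)) g
    ≡⟨ ∑-split d (suc K ℕ.+ e) g ⟩
  ∑ d g ℤ.+ ∑[ j < suc K ℕ.+ e ] g (d ℕ.+ j)
    ≡⟨ cong₂ ℤ._+_ (∑-zero d left) (∑-split (suc K) e (g ∘ (d ℕ.+_))) ⟩
  0ℤ ℤ.+ (∑[ i < suc K ] g (d ℕ.+ i) ℤ.+ ∑[ t < e ] g (d ℕ.+ (suc K ℕ.+ t)))
    ≡⟨ cong₂ (λ u v → 0ℤ ℤ.+ (u ℤ.+ v)) (∑-cong (suc K) (λ i _ → cong f (grid-recentre d K i)))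
                                        (∑-zero e right) ⟩
  0ℤ ℤ.+ (∑ (suc K) (f ∘ grid K) ℤ.+ 0ℤ)
    ≡⟨ trans (ℤ.+-identityˡ _) (ℤ.+-identityʳ _) ⟩
  ∑ (suc K) (f ∘ grid K) ∎
  where
  open ≡-Reasoning
  g : ℕ → ℤ
  g = f ∘ grid (d ℕ.+ (d ℕ.+ K))
  recentred : ∀ {i j} → grid (d ℕ.+ (d ℕ.+ K)) j ≡ grid K i → j ≡ d ℕ.+ i
  recentred {i} eq = grid-injective (d ℕ.+ (d ℕ.+ K)) (trans eq (sym (grid-recentre d K i)))
  left : ∀ j → j < d → g j ≡ 0ℤ
  left j j<d = vanish _ λ i _ eq → ℕ.<⇒≱ j<d (subst (d ≤_) (sym (recentred eq)) (ℕ.m≤m+n d i))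
  right : ∀ t → t < e → g (d ℕ.+ (suc K ℕ.+ t)) ≡ 0ℤ
  right t _ = vanish _ λ i i<1+K eq →
    ℕ.<⇒≱ i<1+K (subst (suc K ≤_) (ℕ.+-cancelˡ-≡ d _ _ (recentred eq)) (ℕ.m≤m+n (suc K) t))

grid-+-grid : ∀ {M} d t X j → d ℕ.+ t ≡ M →
              grid (M ℕ.+ (M ℕ.+ X)) j ℤ.+ grid (1 ℕ.* M) t ≡ grid (d ℕ.+ (d ℕ.+ (M ℕ.+ X))) j
grid-+-grid d t X j refl = recentre (+ d) (+ t) (+ X) (+ j)
  where
  recentre : ∀ d t X j →
    (ℤ.- ((d ℤ.+ t) ℤ.+ ((d ℤ.+ t) ℤ.+ X)) ℤ.+ (+ 2) ℤ.* j) ℤ.+ (ℤ.- ((d ℤ.+ t) ℤ.+ (+ 0)) ℤ.+ (+ 2) ℤ.* t)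
      ≡ ℤ.- (d ℤ.+ (d ℤ.+ ((d ℤ.+ t) ℤ.+ X))) ℤ.+ (+ 2) ℤ.* j
  recentre = ℤ-Solver.solve-∀

module TriangleRows (α m : ℕ) where

  private
    n : ℕ
    n = suc m

  sum-over-I : ∀ k f → sumℤ (map f (I n k)) ≡ ∑ (suc (k ℕ.* m)) (f ∘ grid (k ℕ.* m))
  sum-over-I k f = trans (cong sumℤ (sym (map-∘ {g = f} {f = grid K} (upTo (suc K)))))
                         (sumℤ-map-applyUpTo (f ∘ grid K) (λ j → j) (suc K))
    where K = k ℕ.* m

  row-sum : ∀ k → 𝒜 α n k ≡ ∑ (suc (k ℕ.* m)) (a α n k ∘ grid (k ℕ.* m))
  row-sum k = sum-over-I k (a α n k)

  inI-grid : ∀ k {j} → j < suc (k ℕ.* m) → inI n k (grid (k ℕ.* m) j) ≡ true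
  inI-grid k {j} j<1+K =
    trans (isYes≗does r∈I?) (dec-true r∈I? (Any.map⁺ (Any.applyUpTo⁺ (λ j → j) refl j<1+K)))
    where r∈I? = any? (grid (k ℕ.* m) j ℤ.≟_) (I n k)

  inI-offGrid : ∀ k {r} → OffGrid (k ℕ.* m) r → inI n k r ≡ false
  inI-offGrid k {r} off = trans (isYes≗does r∈I?) (dec-false r∈I? λ r∈I →
    let (i , i<1+K , r≡) = Any.applyUpTo⁻ (λ j → j) (Any.map⁻ r∈I) in off i i<1+K r≡)
    where r∈I? = any? (r ℤ.≟_) (I n k)

  a-vanishes : ∀ k → VanishesOffGrid (k ℕ.* m) (a α n k)
  a-vanishes zero          r off rewrite inI-offGrid zero off          = refl
  a-vanishes (suc zero)    r off rewrite inI-offGrid (suc zero) off    = refl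
  a-vanishes (suc (suc k)) r off rewrite inI-offGrid (suc (suc k)) off = refl

  a-on-grid : ∀ k {j} → j < suc (suc (suc k) ℕ.* m) →
    let r = grid (suc (suc k) ℕ.* m) j in
    a α n (suc (suc k)) r ≡ ∑[ t < suc (1 ℕ.* m) ] a α n (suc k) (r ℤ.+ grid (1 ℕ.* m) t) ℤ.- a α n k r
  a-on-grid k {j} j<1+K rewrite inI-grid (suc (suc k)) j<1+K =
    cong (ℤ._- a α n k r) (sum-over-I 1 (λ s → a α n (suc k) (r ℤ.+ s)))
    where r = grid (suc (suc k) ℕ.* m) j

  shifted-row-sum : ∀ k t → t ≤ m →
    ∑[ j < suc (suc (suc k) ℕ.* m) ] a α n (suc k) (grid (suc (suc k) ℕ.* m) j ℤ.+ grid (1 ℕ.* m) t)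
      ≡ 𝒜 α n (suc k)
  shifted-row-sum k t t≤m = begin
    ∑[ j < suc (m ℕ.+ (m ℕ.+ X)) ] f (grid (m ℕ.+ (m ℕ.+ X)) j ℤ.+ grid (1 ℕ.* m) t)
      ≡⟨ cong (λ N → ∑[ j < N ] f (grid (m ℕ.+ (m ℕ.+ X)) j ℤ.+ grid (1 ℕ.* m) t))
              (recentring (m ∸ t) t X d+t≡m) ⟩
    ∑[ j < d ℕ.+ (suc (m ℕ.+ X) ℕ.+ t) ] f (grid (m ℕ.+ (m ℕ.+ X)) j ℤ.+ grid (1 ℕ.* m) t)
      ≡⟨ ∑-cong (d ℕ.+ (suc (m ℕ.+ X) ℕ.+ t)) (λ j _ → cong f (grid-+-grid d t X j d+t≡m)) ⟩
    ∑ (d ℕ.+ (suc (m ℕ.+ X) ℕ.+ t)) (f ∘ grid (d ℕ.+ (d ℕ.+ (m ℕ.+ X))))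
      ≡⟨ ∑-window (m ℕ.+ X) d t (a-vanishes (suc k)) ⟩
    ∑ (suc (m ℕ.+ X)) (f ∘ grid (m ℕ.+ X))
      ≡⟨ row-sum (suc k) ⟨
    𝒜 α n (suc k) ∎
    where
    open ≡-Reasoning
    X = k ℕ.* m
    d = m ∸ t
    f = a α n (suc k)
    d+t≡m : d ℕ.+ t ≡ m
    d+t≡m = ℕ.m∸n+n≡m t≤m
    recentring : ∀ d t X {M} → d ℕ.+ t ≡ M → suc (M ℕ.+ (M ℕ.+ X)) ≡ d ℕ.+ (suc (M ℕ.+ X) ℕ.+ t)
    recentring d t X refl = lemma d t X
      where
      lemma : ∀ d t X → suc ((d ℕ.+ t) ℕ.+ ((d ℕ.+ t) ℕ.+ X)) ≡ d ℕ.+ (suc ((d ℕ.+ t) ℕ.+ X) ℕ.+ t)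
      lemma = ℕ-Solver.solve-∀

  widened-row-sum : ∀ k → ∑ (suc (suc (suc k) ℕ.* m)) (a α n k ∘ grid (suc (suc k) ℕ.* m)) ≡ 𝒜 α n k
  widened-row-sum k = begin
    ∑ (suc (m ℕ.+ (m ℕ.+ k ℕ.* m))) (a α n k ∘ grid (m ℕ.+ (m ℕ.+ k ℕ.* m)))
      ≡⟨ cong (λ N → ∑ N (a α n k ∘ grid (m ℕ.+ (m ℕ.+ k ℕ.* m)))) (widening m (k ℕ.* m)) ⟩
    ∑ (m ℕ.+ (suc (k ℕ.* m) ℕ.+ m)) (a α n k ∘ grid (m ℕ.+ (m ℕ.+ k ℕ.* m)))
      ≡⟨ ∑-window (k ℕ.* m) m m (a-vanishes k) ⟩
    ∑ (suc (k ℕ.* m)) (a α n k ∘ grid (k ℕ.* m))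
      ≡⟨ row-sum k ⟨
    𝒜 α n k ∎
    where
    open ≡-Reasoning
    widening : ∀ m X → suc (m ℕ.+ (m ℕ.+ X)) ≡ m ℕ.+ (suc X ℕ.+ m)
    widening = ℕ-Solver.solve-∀

  𝒜-recurrence : ∀ k → 𝒜 α n (suc (suc k)) ≡ + n ℤ.* 𝒜 α n (suc k) ℤ.- 𝒜 α n k
  𝒜-recurrence k = begin
    𝒜 α n (suc (suc k))                        ≡⟨ row-sum (suc (suc k)) ⟩
    ∑ (suc K) (a α n (suc (suc k)) ∘ grid K)   ≡⟨ ∑-cong (suc K) (λ _ → a-on-grid k) ⟩
    ∑[ j < suc K ] (∑[ t < suc (1 ℕ.* m) ] f j t ℤ.- a α n k (grid K j))
      ≡⟨ ∑-distrib-− (suc K) (λ j → ∑[ t < suc (1 ℕ.* m) ] f j t) (a α n k ∘ grid K) ⟩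
    ∑[ j < suc K ] ∑[ t < suc (1 ℕ.* m) ] f j t ℤ.- ∑ (suc K) (a α n k ∘ grid K)
      ≡⟨ cong₂ ℤ._-_ shifted-sums (widened-row-sum k) ⟩
    + n ℤ.* 𝒜 α n (suc k) ℤ.- 𝒜 α n k ∎
    where
    open ≡-Reasoning
    K = suc (suc k) ℕ.* m
    f : ℕ → ℕ → ℤ
    f j t = a α n (suc k) (grid K j ℤ.+ grid (1 ℕ.* m) t)
    shifted-sums : ∑[ j < suc K ] ∑[ t < suc (1 ℕ.* m) ] f j t ≡ + n ℤ.* 𝒜 α n (suc k)
    shifted-sums = begin
      ∑[ j < suc K ] ∑[ t < suc (1 ℕ.* m) ] f j t
        ≡⟨ ∑-comm (suc K) (suc (1 ℕ.* m)) f ⟩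
      ∑[ t < suc (1 ℕ.* m) ] ∑[ j < suc K ] f j t
        ≡⟨ ∑-cong (suc (1 ℕ.* m)) (λ t t<1+m →
             shifted-row-sum k t (ℕ.≤-trans (ℕ.≤-pred t<1+m) (ℕ.≤-reflexive (ℕ.*-identityˡ m)))) ⟩
      ∑[ t < suc (1 ℕ.* m) ] 𝒜 α n (suc k)
        ≡⟨ ∑-const (suc (1 ℕ.* m)) _ ⟩
      + suc (1 ℕ.* m) ℤ.* 𝒜 α n (suc k)
        ≡⟨ cong (λ i → + suc i ℤ.* 𝒜 α n (suc k)) (ℕ.*-identityˡ m) ⟩
      + n ℤ.* 𝒜 α n (suc k) ∎

  𝒜-zero : 𝒜 α n 0 ≡ + α
  𝒜-zero rewrite row-sum 0 | inI-grid 0 {0} z<s = ℤ.+-identityʳ (+ α)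

  𝒜-one : 𝒜 α n 1 ≡ + n
  𝒜-one = begin
    𝒜 α n 1                                ≡⟨ row-sum 1 ⟩
    ∑ (suc (1 ℕ.* m)) (a α n 1 ∘ grid (1 ℕ.* m)) ≡⟨ ∑-cong (suc (1 ℕ.* m)) (λ _ → row-one) ⟩
    ∑[ _ < suc (1 ℕ.* m) ] (+ 1)            ≡⟨ ∑-const (suc (1 ℕ.* m)) (+ 1) ⟩
    + suc (1 ℕ.* m) ℤ.* + 1                ≡⟨ ℤ.*-identityʳ _ ⟩
    + suc (1 ℕ.* m)                        ≡⟨ cong (λ i → + suc i) (ℕ.*-identityˡ m) ⟩
    + n                                    ∎
    where
    open ≡-Reasoning
    row-one : ∀ {j} → j < suc (1 ℕ.* m) → a α n 1 (grid (1 ℕ.* m) j) ≡ + 1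
    row-one j< rewrite inI-grid 1 j< = refl

count : {A : Set} → (A → Bool) → List A → ℕ
count p []       = 0
count p (x ∷ xs) = if p x then suc (count p xs) else count p xs

length-filter : ∀ {A : Set} {P : A → Set} (P? : Decidable P) xs →
                length (filter P? xs) ≡ count (does ∘ P?) xs
length-filter P? []       = refl
length-filter P? (x ∷ xs) with does (P? x)
... | true  = cong suc (length-filter P? xs)
... | false = length-filter P? xs

count-++ : ∀ {A : Set} (p : A → Bool) xs ys → count p (xs ++ ys) ≡ count p xs ℕ.+ count p ys
count-++ p []       ys = refl
count-++ p (x ∷ xs) ys with p x
... | true  = cong suc (count-++ p xs ys)
... | false = count-++ p xs ys

count-map : ∀ {A B : Set} (p : B → Bool) (f : A → B) xs → count p (map f xs) ≡ count (p ∘ f) xs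
count-map p f []       = refl
count-map p f (x ∷ xs) with p (f x)
... | true  = cong suc (count-map p f xs)
... | false = count-map p f xs

count-cong : ∀ {A : Set} {p q : A → Bool} → (∀ x → p x ≡ q x) → ∀ xs → count p xs ≡ count q xs
count-cong eq []       = refl
count-cong {p = p} {q} eq (x ∷ xs) rewrite eq x with q x
... | true  = cong suc (count-cong eq xs)
... | false = count-cong eq xs

count-∧ˡ : ∀ {A : Set} b (p : A → Bool) xs → count (λ x → b ∧ p x) xs ≡ (if b then count p xs else 0)
count-∧ˡ true  p xs       = refl
count-∧ˡ false p []       = refl
count-∧ˡ false p (x ∷ xs) = count-∧ˡ false p xs

count-split : ∀ {A : Set} (p q : A → Bool) xs →
              count (λ x → p x ∧ not (q x)) xs ℕ.+ count (λ x → p x ∧ q x) xs ≡ count p xs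
count-split p q []       = refl
count-split p q (x ∷ xs) with p x | q x
... | true  | true  = trans (ℕ.+-suc _ _) (cong suc (count-split p q xs))
... | true  | false = cong suc (count-split p q xs)
... | false | _     = count-split p q xs

count-blockTuples : ∀ n j m (p : List ℕ → Bool) →
  + count p (blockTuples n j (suc m))
    ≡ ∑[ t < n ] (+ count (λ r → p ((j ℕ.* n ℕ.+ suc t) ∷ r)) (blockTuples n (suc j) m))
count-blockTuples n j m p = go (λ t → t) n
  where
  tails = blockTuples n (suc j) m
  go : ∀ g N → + count p (concatMap (λ t → map ((j ℕ.* n ℕ.+ suc t) ∷_) tails) (applyUpTo g N))
             ≡ ∑[ t < N ] (+ count (λ r → p ((j ℕ.* n ℕ.+ suc (g t)) ∷ r)) tails)
  go g zero    = refl
  go g (suc N) = trans (cong +_ (count-++ p (map _ tails) _))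
                       (cong₂ ℤ._+_ (cong +_ (count-map p _ tails)) (go (g ∘ suc) N))

module NoSuccessor (p : ℕ) where

  n : ℕ
  n = suc (suc p)

  noSucc : List ℕ → Bool
  noSucc t = does (noSucc? t)

  continuations : ℕ → ℕ → ℕ → ℕ
  continuations j m x = count (λ r → noSucc (x ∷ r)) (blockTuples n j m)

  endsAt : ℕ → List ℕ → Bool
  endsAt L t = does (last0 t ℕ.≟ L)

  continuationsEndingAt : ℕ → ℕ → ℕ → ℕ → ℕ
  continuationsEndingAt j m x L = count (λ r → noSucc (x ∷ r) ∧ endsAt L (x ∷ r)) (blockTuples n j m)

  entry : ℕ → ℕ → ℕ
  entry j t = j ℕ.* n ℕ.+ suc t

  follows : ℕ → ℕ → ℕ → Bool
  follows j x t = not (does (entry j t ℕ.≟ suc x))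

  continuations-step : ∀ j m x → + continuations j (suc m) x
    ≡ ∑[ t < n ] (+ (if follows j x t then continuations (suc j) m (entry j t) else 0))
  continuations-step j m x = trans (count-blockTuples n j m (λ r → noSucc (x ∷ r))) (∑-cong n λ t _ →
    cong +_ (count-∧ˡ (follows j x t) (λ r → noSucc (entry j t ∷ r)) (blockTuples n (suc j) m)))

  continuationsEndingAt-step : ∀ j m x L → + continuationsEndingAt j (suc m) x L
    ≡ ∑[ t < n ] (+ (if follows j x t then continuationsEndingAt (suc j) m (entry j t) L else 0))
  continuationsEndingAt-step j m x L = trans (count-blockTuples n j m _) (∑-cong n λ t _ → cong +_ (trans
    (count-cong (λ r → Bool.∧-assoc (follows j x t) (noSucc (y t ∷ r)) (endsAt L (y t ∷ r))) tails)
    (count-∧ˡ (follows j x t) (λ r → noSucc (y t ∷ r) ∧ endsAt L (y t ∷ r)) tails)))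
    where
    y = entry j
    tails = blockTuples n (suc j) m

  -- V m and W m count the continuations of an entry lying before, respectively at, the
  -- end of its block.
  V W : ℕ → ℤ
  V zero    = 1ℤ
  V (suc m) = + suc p ℤ.* V m ℤ.+ W m
  W zero    = 1ℤ
  W (suc m) = + p ℤ.* V m ℤ.+ W m

  V-recurrence : ∀ m → V (suc (suc m)) ≡ + n ℤ.* V (suc m) ℤ.- V m
  V-recurrence m = identity (+ p) (V m) (W m)
    where
    identity : ∀ p v w → (1ℤ ℤ.+ p) ℤ.* ((1ℤ ℤ.+ p) ℤ.* v ℤ.+ w) ℤ.+ (p ℤ.* v ℤ.+ w)
                         ≡ (1ℤ ℤ.+ (1ℤ ℤ.+ p)) ℤ.* ((1ℤ ℤ.+ p) ℤ.* v ℤ.+ w) ℤ.- v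
    identity = ℤ-Solver.solve-∀

  follows-true : ∀ j {x t} → entry j t ≢ suc x → follows j x t ≡ true
  follows-true j ne = cong not (dec-false (_ ℕ.≟ _) ne)

  follows-false : ∀ j {x t} → entry j t ≡ suc x → follows j x t ≡ false
  follows-false j eq = cong not (dec-true (_ ℕ.≟ _) eq)

  follows-beyond : ∀ j {x t} → suc x < entry j t → follows j x t ≡ true
  follows-beyond j lt = follows-true j (ℕ.>⇒≢ lt)

  beyond-earlier : ∀ j t {x} → x < j ℕ.* n → suc x < entry j t
  beyond-earlier j t x<jn = ℕ.≤-<-trans x<jn (ℕ.m<m+n (j ℕ.* n) z<s)

  beyond-first : ∀ j t {x} → x ≤ j ℕ.* n → suc x < entry j (suc t)
  beyond-first j t {x} x≤jn = ℕ.≤-<-trans (s≤s x≤jn)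
    (subst (_< entry j (suc t)) (ℕ.+-comm (j ℕ.* n) 1) (ℕ.+-monoʳ-< (j ℕ.* n) (s<s z<s)))

  entry-first : ∀ j → entry j 0 ≡ suc (j ℕ.* n)
  entry-first j = ℕ.+-comm (j ℕ.* n) 1

  entry-last : ∀ j → entry j (suc p) ≡ suc j ℕ.* n
  entry-last j = ℕ.+-comm (j ℕ.* n) n

  entry-≤ : ∀ j {t} → t < n → entry j t ≤ suc j ℕ.* n
  entry-≤ j {t} t<n = subst (entry j t ≤_) (entry-last j) (ℕ.+-monoʳ-≤ (j ℕ.* n) t<n)

  entry-< : ∀ j {t} → t < suc p → entry j t < suc j ℕ.* n
  entry-< j {t} t<1+p = ℕ.<-≤-trans (ℕ.+-monoʳ-< (j ℕ.* n) (ℕ.n<1+n (suc t))) (entry-≤ j (s<s t<1+p))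

  continuations-free : ∀ m j x → x < j ℕ.* n → + continuations j m x ≡ V m
  continuations-blocked : ∀ m j → + continuations j m (j ℕ.* n) ≡ W m

  continuations-free zero    j x _    = refl
  continuations-free (suc m) j x x<jn = begin
    + continuations j (suc m) x        ≡⟨ continuations-step j m x ⟩
    ∑ n g                              ≡⟨ ∑-snoc (suc p) g ⟩
    ∑ (suc p) g ℤ.+ g (suc p)          ≡⟨ cong₂ ℤ._+_ (trans (∑-cong (suc p) earlier) (∑-const (suc p) (V m)))
                                                      last ⟩
    + suc p ℤ.* V m ℤ.+ W m            ∎
    where
    open ≡-Reasoning
    g : ℕ → ℤ
    g t = + (if follows j x t then continuations (suc j) m (entry j t) else 0)
    earlier : ∀ t → t < suc p → g t ≡ V m
    earlier t t<1+p = trans (cong +_ (Bool.if-cong (follows-beyond j (beyond-earlier j t x<jn))))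
      (continuations-free m (suc j) (entry j t) (entry-< j t<1+p))
    last : g (suc p) ≡ W m
    last = trans (cong +_ (Bool.if-cong (follows-beyond j (beyond-earlier j (suc p) x<jn))))
      (trans (cong (+_ ∘ continuations (suc j) m) (entry-last j)) (continuations-blocked m (suc j)))

  continuations-blocked zero    j = refl
  continuations-blocked (suc m) j = begin
    + continuations j (suc m) (j ℕ.* n)    ≡⟨ continuations-step j m (j ℕ.* n) ⟩
    g 0 ℤ.+ ∑ (suc p) (g ∘ suc)            ≡⟨ cong₂ ℤ._+_ first (∑-snoc p (g ∘ suc)) ⟩
    0ℤ ℤ.+ (∑ p (g ∘ suc) ℤ.+ g (suc p))   ≡⟨ ℤ.+-identityˡ _ ⟩
    ∑ p (g ∘ suc) ℤ.+ g (suc p)            ≡⟨ cong₂ ℤ._+_ (trans (∑-cong p middle) (∑-const p (V m))) last ⟩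
    + p ℤ.* V m ℤ.+ W m                    ∎
    where
    open ≡-Reasoning
    g : ℕ → ℤ
    g t = + (if follows j (j ℕ.* n) t then continuations (suc j) m (entry j t) else 0)
    first : g 0 ≡ 0ℤ
    first = cong +_ (Bool.if-cong (follows-false j {j ℕ.* n} {0} (entry-first j)))
    middle : ∀ t → t < p → g (suc t) ≡ V m
    middle t t<p = trans (cong +_ (Bool.if-cong (follows-beyond j (beyond-first j t {j ℕ.* n} ℕ.≤-refl))))
      (continuations-free m (suc j) (entry j (suc t)) (entry-< j (s<s t<p)))
    last : g (suc p) ≡ W m
    last = trans (cong +_ (Bool.if-cong (follows-beyond j (beyond-first j p {j ℕ.* n} ℕ.≤-refl))))
      (trans (cong (+_ ∘ continuations (suc j) m) (entry-last j)) (continuations-blocked m (suc j)))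

  entry-injective : ∀ j {t u} → entry j t ≡ entry j u → t ≡ u
  entry-injective j = ℕ.suc-injective ∘ ℕ.+-cancelˡ-≡ (j ℕ.* n) _ _

  single-ending : ∀ j x c → x ≤ j ℕ.* n → c < suc p → continuationsEndingAt j 1 x (entry j (suc c)) ≡ 1
  single-ending j x c x≤jn c<1+p = ℤ.+-injective (begin
    + continuationsEndingAt j 1 x L                 ≡⟨ continuationsEndingAt-step j 0 x L ⟩
    ∑ n g                                           ≡⟨ ∑-single n (suc c) (s<s c<1+p) elsewhere ⟩
    g (suc c)
      ≡⟨ cong +_ (Bool.if-cong (follows-beyond j (beyond-first j c x≤jn))) ⟩
    + (if endsAt L (entry j (suc c) ∷ []) then 1 else 0)
      ≡⟨ cong +_ (Bool.if-cong {y = 0} (dec-true (L ℕ.≟ L) refl)) ⟩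
    + 1                                             ∎)
    where
    open ≡-Reasoning
    L = entry j (suc c)
    g : ℕ → ℤ
    g t = + (if follows j x t then continuationsEndingAt (suc j) 0 (entry j t) L else 0)
    elsewhere : ∀ t → t < n → t ≢ suc c → g t ≡ 0ℤ
    elsewhere t _ t≢1+c = cong +_ (trans
      (Bool.if-cong-then (follows j x t) (Bool.if-cong (dec-false (_ ℕ.≟ _) (t≢1+c ∘ entry-injective j))))
      (Bool.if-eta (follows j x t)))

  -- Fixing the last entry anywhere but at the start of its block leaves the other entries free.
  continuationsEndingAt-last : ∀ m j x c → x ≤ j ℕ.* n → c < suc p →
    continuationsEndingAt j (suc m) x (entry (j ℕ.+ m) (suc c)) ≡ continuations j m x
  continuationsEndingAt-last zero j x c x≤jn c<1+p rewrite ℕ.+-identityʳ j =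
    single-ending j x c x≤jn c<1+p
  continuationsEndingAt-last (suc m) j x c x≤jn c<1+p rewrite ℕ.+-suc j m = ℤ.+-injective (begin
    + continuationsEndingAt j (suc (suc m)) x L     ≡⟨ continuationsEndingAt-step j (suc m) x L ⟩
    ∑[ t < n ] (+ (if follows j x t then continuationsEndingAt (suc j) (suc m) (entry j t) L else 0))
      ≡⟨ ∑-cong n (λ t t<n → cong +_ (Bool.if-cong-then (follows j x t) {y = 0}
           (continuationsEndingAt-last m (suc j) (entry j t) c (entry-≤ j t<n) c<1+p))) ⟩
    ∑[ t < n ] (+ (if follows j x t then continuations (suc j) m (entry j t) else 0))
      ≡⟨ continuations-step j m x ⟨
    + continuations j (suc m) x                     ∎)
    where
    open ≡-Reasoning
    L = entry (suc j ℕ.+ m) (suc c)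

module GibonacciTuples (a p : ℕ) (a≤p : a ≤ p) where

  open NoSuccessor p

  private
    α : ℕ
    α = suc a

  startingAt : ℕ → ℕ → ℕ
  startingAt k t = count (λ r → does (isGib? α n (suc (suc k)) (suc t ∷ r))) (blockTuples n 1 (suc k))

  card-by-first-entry : ∀ k → + cardRGib α n (suc (suc k)) ≡ ∑[ t < n ] (+ startingAt k t)
  card-by-first-entry k =
    trans (cong +_ (length-filter (isGib? α n (suc (suc k))) (tuples n (suc (suc k)))))
          (count-blockTuples n 0 (suc k) _)

  card-one : + cardRGib α n 1 ≡ + n
  card-one = begin
    + cardRGib α n 1                ≡⟨ cong +_ (length-filter noSucc? (tuples n 1)) ⟩
    + count noSucc (tuples n 1)     ≡⟨ count-blockTuples n 0 0 noSucc ⟩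
    ∑[ _ < n ] (+ 1)                ≡⟨ ∑-const n (+ 1) ⟩
    + n ℤ.* + 1                     ≡⟨ ℤ.*-identityʳ (+ n) ⟩
    + n                             ∎
    where open ≡-Reasoning

  -- the last entry excluded by condition (3) when the first entry is i
  mirror : ℕ → ℕ → ℕ
  mirror K i = suc (n ℕ.* K ∸ i)

  endCond-far : ∀ K {t r} → α ≤ suc t → EndCond α n K (suc t ∷ r)
  endCond-far K α≤1+t = All.map⁺ (All.applyUpTo⁺₁ (λ i → i) a λ i<a (1+t≡1+i , _) →
    ℕ.<⇒≱ i<a (ℕ.≤-pred (subst (α ≤_) 1+t≡1+i α≤1+t)))

  endCond-near : ∀ K {t r} → suc t < α →
                 EndCond α n K (suc t ∷ r) ⇔ (last0 (suc t ∷ r) ≢ mirror K (suc t))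
  endCond-near K {t} 1+t<α = mk⇔
    (λ ec → All.applyUpTo⁻ (λ i → i) a (All.map⁻ ec) (ℕ.≤-pred 1+t<α) ∘ (refl ,_))
    (λ ne → All.map⁺ (All.applyUpTo⁺₁ (λ i → i) a λ { _ (refl , last≡) → ne last≡ }))

  startingAt-far : ∀ k t → α ≤ suc t → startingAt k t ≡ continuations 1 (suc k) (suc t)
  startingAt-far k t α≤1+t = count-cong (λ r →
    trans (cong (noSucc (suc t ∷ r) ∧_) (dec-true (endCond? α n K (suc t ∷ r)) (endCond-far K {t} {r} α≤1+t)))
          (Bool.∧-identityʳ _)) (blockTuples n 1 (suc k))
    where K = suc (suc k)

  startingAt-near : ∀ k t → suc t < α →
    startingAt k t ℕ.+ continuationsEndingAt 1 (suc k) (suc t) (mirror (suc (suc k)) (suc t))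
      ≡ continuations 1 (suc k) (suc t)
  startingAt-near k t 1+t<α = trans
    (cong (ℕ._+ continuationsEndingAt 1 (suc k) (suc t) L) (count-cong (λ r → cong (noSucc (suc t ∷ r) ∧_)
       (does-⇔ (endCond-near K {t} {r} 1+t<α) (endCond? α n K (suc t ∷ r)) (¬? (last0 (suc t ∷ r) ℕ.≟ L))))
       tails))
    (count-split (λ r → noSucc (suc t ∷ r)) (λ r → endsAt L (suc t ∷ r)) tails)
    where
    K = suc (suc k)
    L = mirror K (suc t)
    tails = blockTuples n 1 (suc k)

  mirror-entry : ∀ k t → t ≤ p → mirror (suc (suc k)) (suc t) ≡ entry (1 ℕ.+ k) (suc (p ∸ t))
  mirror-entry k t t≤p = begin
    suc (n ℕ.* suc (suc k) ∸ suc t)         ≡⟨ cong (λ x → suc (x ∸ suc t)) (unroll n k) ⟩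
    suc ((suc k ℕ.* n ℕ.+ n) ∸ suc t)       ≡⟨ cong suc (ℕ.+-∸-assoc (suc k ℕ.* n) (s≤s (ℕ.m≤n⇒m≤1+n t≤p))) ⟩
    suc (suc k ℕ.* n ℕ.+ (suc p ∸ t))       ≡⟨ cong (λ x → suc (suc k ℕ.* n ℕ.+ x)) (ℕ.+-∸-assoc 1 t≤p) ⟩
    suc (suc k ℕ.* n ℕ.+ suc (p ∸ t))       ≡⟨ ℕ.+-suc (suc k ℕ.* n) (suc (p ∸ t)) ⟨
    suc k ℕ.* n ℕ.+ suc (suc (p ∸ t))       ∎
    where
    open ≡-Reasoning
    unroll : ∀ n k → n ℕ.* suc (suc k) ≡ suc k ℕ.* n ℕ.+ n
    unroll = ℕ-Solver.solve-∀

  private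
    first-block : ∀ {x} → x < n → x < 1 ℕ.* n
    first-block {x} = subst (x <_) (sym (ℕ.*-identityˡ n))

    first-free : ∀ m {x} → x < n → + continuations 1 m x ≡ V m
    first-free m x<n = continuations-free m 1 _ (first-block x<n)

    first-blocked : ∀ m → + continuations 1 m n ≡ W m
    first-blocked m =
      trans (cong (+_ ∘ continuations 1 m) (sym (ℕ.*-identityˡ n))) (continuations-blocked m 1)

  startingAt-before : ∀ k t → t < a → + startingAt k t ≡ V (suc k) ℤ.- V k
  startingAt-before k t t<a = begin
    + startingAt k t                    ≡⟨ m≡[m+n]-n (+ startingAt k t) (+ e) ⟩
    + (startingAt k t ℕ.+ e) ℤ.- + e   ≡⟨ cong₂ (λ x y → + x ℤ.- y) (startingAt-near k t (s<s t<a)) excluded ⟩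
    + continuations 1 (suc k) (suc t) ℤ.- V k ≡⟨ cong (ℤ._- V k) (first-free (suc k) 1+t<n) ⟩
    V (suc k) ℤ.- V k                   ∎
    where
    open ≡-Reasoning
    e = continuationsEndingAt 1 (suc k) (suc t) (mirror (suc (suc k)) (suc t))
    t≤p : t ≤ p
    t≤p = ℕ.≤-trans (ℕ.<⇒≤ t<a) a≤p
    1+t<n : suc t < n
    1+t<n = s<s (s≤s t≤p)
    excluded : + e ≡ V k
    excluded = begin
      + e
        ≡⟨ cong (+_ ∘ continuationsEndingAt 1 (suc k) (suc t)) (mirror-entry k t t≤p) ⟩
      + continuationsEndingAt 1 (suc k) (suc t) (entry (1 ℕ.+ k) (suc (p ∸ t)))
        ≡⟨ cong +_ (continuationsEndingAt-last k 1 (suc t) (p ∸ t) (ℕ.<⇒≤ (first-block 1+t<n))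
                                               (s≤s (ℕ.m∸n≤m p t))) ⟩
      + continuations 1 k (suc t)
        ≡⟨ first-free k 1+t<n ⟩
      V k ∎
    m≡[m+n]-n : ∀ m n → m ≡ m ℤ.+ n ℤ.- n
    m≡[m+n]-n = ℤ-Solver.solve-∀

  startingAt-between : ∀ k t → a ≤ t → t < suc p → + startingAt k t ≡ V (suc k)
  startingAt-between k t a≤t t<1+p =
    trans (cong +_ (startingAt-far k t (s≤s a≤t))) (first-free (suc k) (s<s t<1+p))

  startingAt-last : ∀ k → + startingAt k (suc p) ≡ W (suc k)
  startingAt-last k =
    trans (cong +_ (startingAt-far k (suc p) (s≤s (ℕ.m≤n⇒m≤1+n a≤p)))) (first-blocked (suc k))

  card-expansion : ∀ k → + cardRGib α n (suc (suc k)) ≡ V (suc (suc k)) ℤ.- + a ℤ.* V k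
  card-expansion k = begin
    + cardRGib α n (suc (suc k))                 ≡⟨ card-by-first-entry k ⟩
    ∑ n s                                         ≡⟨ ∑-snoc (suc p) s ⟩
    ∑ (suc p) s ℤ.+ s (suc p)                     ≡⟨ cong (λ N → ∑ N s ℤ.+ s (suc p)) a+[1+q]≡1+p ⟨
    ∑ (a ℕ.+ suc q) s ℤ.+ s (suc p)               ≡⟨ cong (ℤ._+ s (suc p)) (∑-split a (suc q) s) ⟩
    ∑ a s ℤ.+ ∑[ j < suc q ] s (a ℕ.+ j) ℤ.+ s (suc p)
      ≡⟨ cong₂ (λ x y → x ℤ.+ y ℤ.+ s (suc p)) (trans (∑-cong a before) (∑-const a _))
                                               (trans (∑-cong (suc q) between) (∑-const (suc q) _)) ⟩
    + a ℤ.* (V (suc k) ℤ.- V k) ℤ.+ + suc q ℤ.* V (suc k) ℤ.+ s (suc p)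
      ≡⟨ cong (ℤ._+_ (+ a ℤ.* (V (suc k) ℤ.- V k) ℤ.+ + suc q ℤ.* V (suc k))) (startingAt-last k) ⟩
    + a ℤ.* (V (suc k) ℤ.- V k) ℤ.+ + suc q ℤ.* V (suc k) ℤ.+ W (suc k)
      ≡⟨ regroup (+ a) (+ suc q) (V (suc k)) (V k) (W (suc k)) ⟩
    + (a ℕ.+ suc q) ℤ.* V (suc k) ℤ.+ W (suc k) ℤ.- + a ℤ.* V k
      ≡⟨ cong (λ N → + N ℤ.* V (suc k) ℤ.+ W (suc k) ℤ.- + a ℤ.* V k) a+[1+q]≡1+p ⟩
    V (suc (suc k)) ℤ.- + a ℤ.* V k ∎
    where
    open ≡-Reasoning
    s : ℕ → ℤ
    s = +_ ∘ startingAt k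
    q = p ∸ a
    a+[1+q]≡1+p : a ℕ.+ suc q ≡ suc p
    a+[1+q]≡1+p = trans (ℕ.+-suc a q) (cong suc (ℕ.m+[n∸m]≡n a≤p))
    before : ∀ t → t < a → s t ≡ V (suc k) ℤ.- V k
    before t t<a = startingAt-before k t t<a
    between : ∀ j → j < suc q → s (a ℕ.+ j) ≡ V (suc k)
    between j j<1+q = startingAt-between k (a ℕ.+ j) (ℕ.m≤m+n a j)
      (subst (a ℕ.+ j <_) a+[1+q]≡1+p (ℕ.+-monoʳ-< a j<1+q))
    regroup : ∀ a q v₁ v₀ w → a ℤ.* (v₁ ℤ.- v₀) ℤ.+ q ℤ.* v₁ ℤ.+ w ≡ (a ℤ.+ q) ℤ.* v₁ ℤ.+ w ℤ.- a ℤ.* v₀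
    regroup = ℤ-Solver.solve-∀

parity : ∀ k → (k ℕ.% 2 ≡ 0 × suc k ℕ.% 2 ≡ 1) ⊎ (k ℕ.% 2 ≡ 1 × suc k ℕ.% 2 ≡ 0)
parity zero          = inj₁ (refl , refl)
parity (suc zero)    = inj₂ (refl , refl)
parity (suc (suc k)) = parity k

𝒢-recurrence : ∀ α n k → 𝒢 α n (suc (suc k)) ≡ + n ℤ.* 𝒢 α n (suc k) ℤ.- 𝒢 α n k
𝒢-recurrence α n k with parity k
... | inj₁ (k-even , 1+k-odd) rewrite k-even | 1+k-odd =
  even (+ n) (Gbar α (+ n ℤ.* + n) (suc k)) (Gbar α (+ n ℤ.* + n) k)
  where
  even : ∀ n g₁ g₀ → 1ℤ ℤ.* ((n ℤ.* n) ℤ.* 1ℤ ℤ.* g₁ ℤ.- g₀) ≡ n ℤ.* (n ℤ.* 1ℤ ℤ.* g₁) ℤ.- 1ℤ ℤ.* g₀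
  even = ℤ-Solver.solve-∀
... | inj₂ (k-odd , 1+k-even) rewrite k-odd | 1+k-even =
  odd (+ n) (Gbar α (+ n ℤ.* + n) (suc k)) (Gbar α (+ n ℤ.* + n) k)
  where
  odd : ∀ n g₁ g₀ → n ℤ.* 1ℤ ℤ.* (1ℤ ℤ.* g₁ ℤ.- g₀) ≡ n ℤ.* (1ℤ ℤ.* g₁) ℤ.- n ℤ.* 1ℤ ℤ.* g₀
  odd = ℤ-Solver.solve-∀

-- h is v with c times its second shift subtracted, the missing values h 0, h 1 coming
-- from extending v backwards by v (-1) = 0, v (-2) = -1.
recurrence-shifted-difference : ∀ {N c : ℤ} {v h : ℕ → ℤ} →
  v 0 ≡ 1ℤ → v 1 ≡ N → (∀ k → v (suc (suc k)) ≡ N ℤ.* v (suc k) ℤ.- v k) →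
  h 0 ≡ 1ℤ ℤ.+ c → h 1 ≡ N → (∀ k → h (suc (suc k)) ≡ v (suc (suc k)) ℤ.- c ℤ.* v k) →
  ∀ k → h (suc (suc k)) ≡ N ℤ.* h (suc k) ℤ.- h k
recurrence-shifted-difference {N} {c} v₀ v₁ v-rec h₀ h₁ h≡ zero
  rewrite h≡ 0 | v-rec 0 | h₁ | h₀ | v₁ | v₀ = identity N c
  where
  identity : ∀ N c → N ℤ.* N ℤ.- 1ℤ ℤ.- c ℤ.* 1ℤ ≡ N ℤ.* N ℤ.- (1ℤ ℤ.+ c)
  identity = ℤ-Solver.solve-∀
recurrence-shifted-difference {N} {c} {v} v₀ v₁ v-rec h₀ h₁ h≡ (suc zero)
  rewrite h≡ 1 | h≡ 0 | v-rec 1 | h₁ | v₁ | v₀ = identity N c (v 2)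
  where
  identity : ∀ N c v₂ → N ℤ.* v₂ ℤ.- N ℤ.- c ℤ.* N ≡ N ℤ.* (v₂ ℤ.- c ℤ.* 1ℤ) ℤ.- N
  identity = ℤ-Solver.solve-∀
recurrence-shifted-difference {N} {c} {v} v₀ v₁ v-rec h₀ h₁ h≡ (suc (suc k))
  rewrite h≡ (suc (suc k)) | h≡ (suc k) | h≡ k | v-rec (suc (suc k)) | v-rec k =
    identity N c (v (3 ℕ.+ k)) (v (suc k)) (v k)
  where
  identity : ∀ N c v₃ v₁ v₀ → N ℤ.* v₃ ℤ.- (N ℤ.* v₁ ℤ.- v₀) ℤ.- c ℤ.* (N ℤ.* v₁ ℤ.- v₀)
                              ≡ N ℤ.* (v₃ ℤ.- c ℤ.* v₁) ℤ.- (N ℤ.* v₁ ℤ.- v₀ ℤ.- c ℤ.* v₀)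
  identity = ℤ-Solver.solve-∀

ℋ-recurrence : ∀ a p → a ≤ p → ∀ k → ℋ (suc a) (suc (suc p)) (suc (suc k))
               ≡ + suc (suc p) ℤ.* ℋ (suc a) (suc (suc p)) (suc k) ℤ.- ℋ (suc a) (suc (suc p)) k
ℋ-recurrence a p a≤p = recurrence-shifted-difference {c = + a} {v = V} {h = ℋ (suc a) (suc (suc p))}
  refl V-one V-recurrence refl card-one card-expansion
  where
  open NoSuccessor p using (V; V-recurrence)
  open GibonacciTuples a p a≤p using (card-one; card-expansion)
  V-one : V 1 ≡ + suc (suc p)
  V-one = trans (cong (ℤ._+ 1ℤ) (ℤ.*-identityʳ (+ suc p))) (ℤ.+-comm (+ suc p) 1ℤ)

IsGibonacci : ℕ → ℕ → (ℕ → ℤ) → Set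
IsGibonacci α n x = x 0 ≡ + α × x 1 ≡ + n × (∀ k → x (suc (suc k)) ≡ + n ℤ.* x (suc k) ℤ.- x k)

𝒳-isGibonacci : ∀ α n → 1 ≤ α → α < n → (X : Which) → IsGibonacci α n (𝒳 X α n)
𝒳-isGibonacci (suc a) (suc (suc p)) _ (s≤s (s≤s a≤p)) A = 𝒜-zero , 𝒜-one , 𝒜-recurrence
  where open TriangleRows (suc a) (suc p)
𝒳-isGibonacci (suc a) (suc (suc p)) _ (s≤s (s≤s a≤p)) G =
  ℤ.*-identityˡ (+ suc a) , trans (ℤ.*-identityʳ _) (ℤ.*-identityʳ _) , 𝒢-recurrence (suc a) (suc (suc p))
𝒳-isGibonacci (suc a) (suc (suc p)) _ (s≤s (s≤s a≤p)) H =
  refl , GibonacciTuples.card-one a p a≤p , ℋ-recurrence a p a≤p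

gibonacci-n≡2 : ∀ α x → 1 ≤ α → α < 2 → IsGibonacci α 2 x → ∀ k → x k ≡ + suc k
gibonacci-n≡2 (suc zero) x _ _ (x₀ , x₁ , x-rec) =
  recurrence-unique {N = + 2} x-rec counting x₀ x₁
  where
  open LinearRecurrence ℤ.+-*-commutativeRing using (recurrence-unique)
  counting : ∀ k → + suc (suc (suc k)) ≡ + 2 ℤ.* + suc (suc k) ℤ.- + suc k
  counting k = identity (+ k)
    where
    identity : ∀ k → 1ℤ ℤ.+ (1ℤ ℤ.+ (1ℤ ℤ.+ k)) ≡ + 2 ℤ.* (1ℤ ℤ.+ (1ℤ ℤ.+ k)) ℤ.- (1ℤ ℤ.+ k)
    identity = ℤ-Solver.solve-∀
gibonacci-n≡2 (suc (suc _)) x _ (s≤s (s≤s ())) _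

-- opened only now: the section on ℚ(√D) uses these names for the rational operations
open import Data.Integer using (_*_; _-_)

-- 2 ≤ n already follows from 1 ≤ α < n, and the closed form is an identity in ℚ(√(n² − 4))
-- for every n: 2 < n is only what makes this ring a subfield of ℝ.
theorem5p4 : (α n : ℕ) → 1 ≤ α → α < n → 2 ≤ n → (X : Which) →
    (𝒳 X α n 0 ≡ + α)
    × (𝒳 X α n 1 ≡ + n)
    × (∀ k → 𝒳 X α n (suc (suc k)) ≡ (+ n) * 𝒳 X α n (suc k) - 𝒳 X α n k)
    × (n ≡ 2 → ∀ k → 𝒳 X α n k ≡ + suc k)
    × (2 < n → ∀ k → ClosedForm α n k (𝒳 X α n k))
theorem5p4 α n 1≤α α<n _ X with 𝒳-isGibonacci α n 1≤α α<n X
... | gibonacci@(x₀ , x₁ , x-rec) =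
  x₀ , x₁ , x-rec ,
  (λ { refl → gibonacci-n≡2 α (𝒳 X α 2) 1≤α α<n gibonacci }) ,
  (λ _ → Binet.closed-form n α (𝒳 X α n) x₀ x₁ x-rec)
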